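{- Let $F$ be a graph and let $F_0$ be obtained from $F$ by removing all universal vertices of $F$. Then $W^*_\kappa[F]\ge W^*[F_0]$.
   Context: Graphs are finite, simple, undirected, loopless. A vertex is universal if it is adjacent to all other vertices. First-order sentences about graphs use only adjacency $\sim$ and equality $=$. Write $F\sqsubset G$ if $G$ contains an induced copy of $F$. For non-isomorphic $G,H$, $W(G,H)$ is the minimum number of distinct variables in a first-order sentence true on one and false on the other. $W^*[F]=\max\{W(G,H):F\sqsubset G,\ F\not\sqsubset H\}$, and $W^*_\kappa[F]=\min_s\max\{W(G,H): F\sqsubset G,\ F\not\sqsubset H,\ G\text{ and }H\text{ both }s\text{ -connected}\}$. -}

module Defs where

open import Data.Nat using (ℕ; _<_)
open import Data.Fin using (Fin; _≟_)
open import Data.Fin.Subset using (Subset; _∈_; _∉_; ∣_∣)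
open import Data.Bool using (Bool; true; false; not; _∧_; if_then_else_)
open import Data.List using (allFin)
open import Data.Bool.ListAction using (any)
open import Data.Maybe using (Maybe; just; nothing)
open import Data.Product using (Σ; _×_; ∃)
open import Relation.Nullary using (¬_; does)
open import Relation.Binary.PropositionalEquality using (_≡_; _≢_)
open import Function.Definitions using (Injective)

record Graph : Set where
  field
    n     : ℕ
    adj   : Fin n → Fin n → Bool
    sym   : ∀ u v → adj u v ≡ adj v u
    irrefl : ∀ v → adj v v ≡ false
open Graph public

Universal : (G : Graph) → Fin (n G) → Set
Universal G v = ∀ u → u ≢ v → adj G v u ≡ true

record InducedEmb (F G : Graph) : Set where
  field
    map  : Fin (n F) → Fin (n G)
    inj  : Injective _≡_ _≡_ map
    pres : ∀ x y → adj G (map x) (map y) ≡ adj F x y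
open InducedEmb public

_⊏_ : Graph → Graph → Set
F ⊏ G = InducedEmb F G

-- F₀ is (an isomorphic copy of) F with all universal vertices removed:
-- an induced embedding of F₀ into F whose image is exactly the set of
-- non-universal vertices of F.

IsRemoveUniversal : (F F₀ : Graph) → Set
IsRemoveUniversal F F₀ =
  Σ (InducedEmb F₀ F) λ e →
    (∀ x → ¬ Universal F (map e x)) ×
    (∀ v → ¬ Universal F v → ∃ λ x → map e x ≡ v)

-- reachability in G - S (u, v assumed outside S)
data Reach (G : Graph) (S : Subset (n G)) : Fin (n G) → Fin (n G) → Set where
  here : ∀ {u} → Reach G S u u
  step : ∀ {u w v} → adj G u w ≡ true → w ∉ S → Reach G S w v → Reach G S u v

SConnected : ℕ → Graph → Set
SConnected s G =
  (s < n G) ×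
  (∀ (S : Subset (n G)) → ∣ S ∣ < s →
     ∀ u v → u ∉ S → v ∉ S → Reach G S u v)

-- First-order logic of graphs with k variables (x₀ … x_{k-1});
-- atoms: adjacency and equality. Connectives ¬, ∧, ∃ (the others are
-- definable without extra variables).

data Form (k : ℕ) : Set where
  Adj  : Fin k → Fin k → Form k
  Eq   : Fin k → Fin k → Form k
  Not  : Form k → Form k
  And  : Form k → Form k → Form k
  Ex   : Fin k → Form k → Form k

data ClosedIn {k : ℕ} (B : Subset k) : Form k → Set where
  adjC : ∀ {x y} → x ∈ B → y ∈ B → ClosedIn B (Adj x y)
  eqC  : ∀ {x y} → x ∈ B → y ∈ B → ClosedIn B (Eq x y)
  notC : ∀ {φ} → ClosedIn B φ → ClosedIn B (Not φ)
  andC : ∀ {φ ψ} → ClosedIn B φ → ClosedIn B ψ → ClosedIn B (And φ ψ)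
  exC  : ∀ {x φ} → ClosedIn (B Data.Fin.Subset.∪ Data.Fin.Subset.⁅ x ⁆) φ → ClosedIn B (Ex x φ)

Sentence : ∀ {k} → Form k → Set
Sentence {k} φ = ClosedIn Data.Fin.Subset.⊥ φ

Assign : ℕ → Graph → Set
Assign k G = Fin k → Maybe (Fin (n G))

eval : ∀ {k} (G : Graph) → Form k → Assign k G → Bool
eval G (Adj x y) ρ with ρ x | ρ y
... | just a | just b = adj G a b
... | _      | _      = false
eval G (Eq x y) ρ with ρ x | ρ y
... | just a | just b = does (a ≟ b)
... | _      | _      = false
eval G (Not φ) ρ = not (eval G φ ρ)
eval G (And φ ψ) ρ = eval G φ ρ ∧ eval G ψ ρ
eval G (Ex x φ) ρ =
  any (λ a → eval G φ (λ y → if does (x ≟ y) then just a else ρ y)) (allFin (n G))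

_⊨_ : ∀ {k} → Graph → Form k → Bool
G ⊨ φ = eval G φ (λ _ → nothing)

Distinguishable : ℕ → Graph → Graph → Set
Distinguishable k G H = Σ (Form k) λ φ → Sentence φ × ((G ⊨ φ) ≢ (H ⊨ φ))

-- W(G,H) ≥ W(G₀,H₀): every k for which G,H are k-variable distinguishable
-- also makes G₀,H₀ k-variable distinguishable.
W≥ : (G H G₀ H₀ : Graph) → Set
W≥ G H G₀ H₀ = ∀ k → Distinguishable k G H → Distinguishable k G₀ H₀

-- Join G₀ and H₀ with a clique K_m, where m exceeds s and the number of vertices of F.
-- A clique vertex is universal and some clique vertex survives the deletion of fewer
-- than s vertices, so both joins are s-connected. F embeds into G₀ ⊕ K_m by sending
-- its universal vertices to distinct clique vertices and F₀ into G₀. Conversely an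
-- induced embedding reflects universality, so in an embedding of F into H₀ ⊕ K_m no
-- vertex of F₀ lands in the clique, whence F₀ embeds into H₀. Finally a k-variable
-- sentence about a join translates into a k-variable sentence about the base graph:
-- a variable sitting on a clique vertex is remembered symbolically, and a quantifier
-- splits into a quantifier over the base graph and a disjunction over the m clique
-- vertices.
module Submission where

open import Data.Bool using (Bool; true; false; not; _∧_; _∨_; if_then_else_)
open import Data.Bool.Properties using (∧-inverseʳ; ∨-assoc) renaming (_≟_ to _≟ᵇ_)
open import Data.Bool.ListAction using (any)
open import Data.Empty using (⊥-elim)
open import Data.Fin using (Fin; zero; suc; _↑ˡ_; _↑ʳ_; splitAt; _≟_; inject≤)
open import Data.Fin.Properties
  using (splitAt-↑ˡ; splitAt-↑ʳ; splitAt⁻¹-↑ˡ; splitAt⁻¹-↑ʳ; ↑ˡ-injective; ↑ʳ-injective; inject≤-injective; all?)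
open import Data.Fin.Subset using (Subset; _∈_; _∉_; _∪_; ⁅_⁆; ∣_∣; inside; outside)
open import Data.Fin.Subset.Properties using (x∈p∪q⁺; x∈p∪q⁻; x∈⁅x⁆; x∈⁅y⁆⇒x≡y; ∣p∣≤∣x∷p∣)
open import Data.List using (tabulate)
open import Data.Maybe using (Maybe; just; nothing)
import Data.Maybe as Maybe
open import Data.Nat using (ℕ; zero; suc; _+_; _<_; _≤_; s≤s)
open import Data.Nat.Properties using (≤-trans; <-trans; <-≤-trans; m≤m+n; m≤n+m; m≤n⇒m≤1+n)
open import Data.Product using (Σ; ∃; _×_; _,_; proj₁; proj₂)
open import Data.Sum using (_⊎_; inj₁; inj₂)
open import Data.Vec using (_∷_; here; there)
open import Function using (_∘_; id; case_of_)
open import Function.Bundles using (mk⇔)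
open import Function.Definitions using (Injective)
open import Relation.Nullary using (¬_; Dec; yes; no; does)
open import Relation.Nullary.Decidable using (dec-true; dec-false; does-⇔; ¬?; _→-dec_)
open import Relation.Binary.PropositionalEquality
  using (_≡_; _≢_; refl; sym; trans; cong; cong₂; subst; module ≡-Reasoning)

open import Defs hiding (sym)

does-refl : ∀ {k} (a : Fin k) → does (a ≟ a) ≡ true
does-refl a = dec-true (a ≟ a) refl

does-≟-injective : ∀ {a b} (f : Fin a → Fin b) → Injective _≡_ _≡_ f →
                   ∀ x y → does (f x ≟ f y) ≡ does (x ≟ y)
does-≟-injective f f-inj x y = does-⇔ (mk⇔ f-inj (cong f)) (f x ≟ f y) (x ≟ y)

update : ∀ {k} {A : Set} → (Fin k → A) → Fin k → A → Fin k → A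
update ρ x a y = if does (x ≟ y) then a else ρ y

anyFin : ∀ {k} → (Fin k → Bool) → Bool
anyFin {zero}  P = false
anyFin {suc k} P = P zero ∨ anyFin (P ∘ suc)

any-tabulate : ∀ {A : Set} {k} (P : A → Bool) (f : Fin k → A) → any P (tabulate f) ≡ anyFin (P ∘ f)
any-tabulate {k = zero}  P f = refl
any-tabulate {k = suc k} P f = cong (P (f zero) ∨_) (any-tabulate P (f ∘ suc))

anyFin-cong : ∀ {k} {P Q : Fin k → Bool} → (∀ i → P i ≡ Q i) → anyFin P ≡ anyFin Q
anyFin-cong {zero}  P≡Q = refl
anyFin-cong {suc k} P≡Q = cong₂ _∨_ (P≡Q zero) (anyFin-cong (P≡Q ∘ suc))

anyFin-+ : ∀ a {b} (P : Fin (a + b) → Bool) → anyFin P ≡ anyFin (P ∘ (_↑ˡ b)) ∨ anyFin (P ∘ (a ↑ʳ_))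
anyFin-+ zero    P = refl
anyFin-+ (suc a) P = trans (cong (P zero ∨_) (anyFin-+ a (P ∘ suc))) (sym (∨-assoc (P zero) _ _))

∃∉ : ∀ {b} (S : Subset b) → ∣ S ∣ < b → ∃ λ j → j ∉ S
∃∉ (outside ∷ S) _ = zero , λ ()
∃∉ (inside ∷ S) (s≤s ∣S∣<b) with ∃∉ S ∣S∣<b
... | j , j∉S = suc j , λ { (there j∈S) → j∉S j∈S }

∃↑ʳ∉ : ∀ a {b} (S : Subset (a + b)) → ∣ S ∣ < b → ∃ λ j → a ↑ʳ j ∉ S
∃↑ʳ∉ zero    S       ∣S∣<b = ∃∉ S ∣S∣<b
∃↑ʳ∉ (suc a) (x ∷ S) ∣S∣<b with ∃↑ʳ∉ a S (≤-trans (s≤s (∣p∣≤∣x∷p∣ x S)) ∣S∣<b)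
... | j , j∉S = j , λ { (there j∈S) → j∉S j∈S }

universal? : (G : Graph) (v : Fin (n G)) → Dec (Universal G v)
universal? G v = all? λ u → ¬? (u ≟ v) →-dec adj G v u ≟ᵇ true

universal-adj : (G : Graph) {v : Fin (n G)} → Universal G v → ∀ u → adj G v u ≡ not (does (v ≟ u))
universal-adj G {v} uv u with v ≟ u
... | yes refl = irrefl G v
... | no v≢u   = uv u (v≢u ∘ sym)

universal-reflect : ∀ {F G} (h : F ⊏ G) {v} → Universal G (map h v) → Universal F v
universal-reflect h {v} uhv u u≢v = trans (sym (pres h v u)) (uhv (map h u) (u≢v ∘ inj h))

Reach-from-universal : (G : Graph) {S : Subset (n G)} {w v : Fin (n G)} →
                       Universal G w → v ∉ S → Reach G S w v
Reach-from-universal G {w = w} {v} uw v∉S with v ≟ w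
... | yes refl = here
... | no v≢w   = step (uw v v≢w) v∉S here

Reach-via-universal : (G : Graph) {S : Subset (n G)} {w u v : Fin (n G)} →
                      Universal G w → w ∉ S → v ∉ S → Reach G S u v
Reach-via-universal G {w = w} {u} uw w∉S v∉S with u ≟ w
... | yes refl = Reach-from-universal G uw v∉S
... | no u≢w   = step (trans (Graph.sym G u w) (uw u u≢w)) w∉S (Reach-from-universal G uw v∉S)

⊏-trans : ∀ {F G H} → F ⊏ G → G ⊏ H → F ⊏ H
⊏-trans f g = record
  { map  = map g ∘ map f
  ; inj  = inj f ∘ inj g
  ; pres = λ x y → trans (pres g (map f x) (map f y)) (pres f x y)
  }

adj⊕ : (G : Graph) (m : ℕ) → Fin (n G) ⊎ Fin m → Fin (n G) ⊎ Fin m → Bool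
adj⊕ G m (inj₁ a) (inj₁ b) = adj G a b
adj⊕ G m (inj₂ i) (inj₂ j) = not (does (i ≟ j))
adj⊕ G m _        _        = true

adj⊕-sym : ∀ G m u v → adj⊕ G m u v ≡ adj⊕ G m v u
adj⊕-sym G m (inj₁ a) (inj₁ b) = Graph.sym G a b
adj⊕-sym G m (inj₁ a) (inj₂ j) = refl
adj⊕-sym G m (inj₂ i) (inj₁ b) = refl
adj⊕-sym G m (inj₂ i) (inj₂ j) = cong not (does-⇔ (mk⇔ sym sym) (i ≟ j) (j ≟ i))

adj⊕-irrefl : ∀ G m u → adj⊕ G m u u ≡ false
adj⊕-irrefl G m (inj₁ a) = irrefl G a
adj⊕-irrefl G m (inj₂ i) = cong not (does-refl i)

infix 25 _⊕K_
_⊕K_ : Graph → ℕ → Graph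
G ⊕K m = record
  { n      = n G + m
  ; adj    = λ u v → adj⊕ G m (splitAt (n G) u) (splitAt (n G) v)
  ; sym    = λ u v → adj⊕-sym G m (splitAt (n G) u) (splitAt (n G) v)
  ; irrefl = λ u → adj⊕-irrefl G m (splitAt (n G) u)
  }

module Join (G : Graph) (m : ℕ) where

  J : Graph
  J = G ⊕K m

  base : Fin (n G) → Fin (n J)
  base a = a ↑ˡ m

  apex : Fin m → Fin (n J)
  apex i = n G ↑ʳ i

  base-injective : Injective _≡_ _≡_ base
  base-injective {a} {b} = ↑ˡ-injective m a b

  apex-injective : Injective _≡_ _≡_ apex
  apex-injective {i} {j} = ↑ʳ-injective (n G) i j

  base≢apex : ∀ a i → base a ≢ apex i
  base≢apex a i eq with trans (sym (splitAt-↑ˡ (n G) a m))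
                              (trans (cong (splitAt (n G)) eq) (splitAt-↑ʳ (n G) m i))
  ... | ()

  adj-base-base : ∀ a b → adj J (base a) (base b) ≡ adj G a b
  adj-base-base a b rewrite splitAt-↑ˡ (n G) a m | splitAt-↑ˡ (n G) b m = refl

  apex-universal : ∀ i → Universal J (apex i)
  apex-universal i z z≢apex rewrite splitAt-↑ʳ (n G) m i with splitAt (n G) z in eq
  ... | inj₁ _ = refl
  ... | inj₂ j = cong not (dec-false (i ≟ j) λ { refl → z≢apex (sym (splitAt⁻¹-↑ʳ eq)) })

  adj-apex-base : ∀ i b → adj J (apex i) (base b) ≡ true
  adj-apex-base i b = apex-universal i (base b) (base≢apex b i)

  adj-base-apex : ∀ a j → adj J (base a) (apex j) ≡ true
  adj-base-apex a j = trans (Graph.sym J (base a) (apex j)) (adj-apex-base j a)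

  adj-apex-apex : ∀ i j → adj J (apex i) (apex j) ≡ not (does (i ≟ j))
  adj-apex-apex i j = trans (universal-adj J (apex-universal i) (apex j))
                            (cong not (does-≟-injective apex apex-injective i j))

  sConnected : ∀ {s} → s < m → SConnected s J
  sConnected s<m = <-≤-trans s<m (m≤n+m m (n G)) , connected
    where
    connected : ∀ S → ∣ S ∣ < _ → ∀ u v → u ∉ S → v ∉ S → Reach J S u v
    connected S ∣S∣<s u v _ v∉S with ∃↑ʳ∉ (n G) S (<-trans ∣S∣<s s<m)
    ... | i , apex∉S = Reach-via-universal J (apex-universal i) apex∉S v∉S

  base-⊏ : G ⊏ J
  base-⊏ = record { map = base ; inj = base-injective ; pres = adj-base-base }

  unbase : ∀ z → (∀ i → z ≢ apex i) → ∃ λ a → base a ≡ z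
  unbase z z≢apex with splitAt (n G) z in eq
  ... | inj₁ a = a , splitAt⁻¹-↑ˡ eq
  ... | inj₂ i = ⊥-elim (z≢apex i (sym (splitAt⁻¹-↑ʳ eq)))

  ⊏-avoiding-apexes : ∀ {K} (h : K ⊏ J) → (∀ x i → map h x ≢ apex i) → K ⊏ G
  ⊏-avoiding-apexes {K} h avoids = record { map = pre ; inj = pre-injective ; pres = pre-pres }
    where
    pre : Fin (n K) → Fin (n G)
    pre x = proj₁ (unbase (map h x) (avoids x))

    base-pre : ∀ x → base (pre x) ≡ map h x
    base-pre x = proj₂ (unbase (map h x) (avoids x))

    pre-injective : Injective _≡_ _≡_ pre
    pre-injective {x} {y} eq = inj h (trans (sym (base-pre x)) (trans (cong base eq) (base-pre y)))

    pre-pres : ∀ x y → adj G (pre x) (pre y) ≡ adj K x y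
    pre-pres x y = begin
      adj G (pre x) (pre y)                ≡⟨ sym (adj-base-base (pre x) (pre y)) ⟩
      adj J (base (pre x)) (base (pre y))  ≡⟨ cong₂ (adj J) (base-pre x) (base-pre y) ⟩
      adj J (map h x) (map h y)            ≡⟨ pres h x y ⟩
      adj K x y                            ∎
      where open ≡-Reasoning

module _ {F F₀ : Graph} (R : IsRemoveUniversal F F₀) where

  private
    e : F₀ ⊏ F
    e = proj₁ R

    image-nonuniversal : ∀ x → ¬ Universal F (map e x)
    image-nonuniversal = proj₁ (proj₂ R)

    cover : ∀ v → ¬ Universal F v → ∃ λ x → map e x ≡ v
    cover = proj₂ (proj₂ R)

  ⊏-⊕K⁻¹ : ∀ {H m} → F ⊏ H ⊕K m → F₀ ⊏ H
  ⊏-⊕K⁻¹ {H} {m} h = ⊏-avoiding-apexes (⊏-trans e h) avoids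
    where
    open Join H m
    avoids : ∀ x i → map h (map e x) ≢ apex i
    avoids x i eq = image-nonuniversal x
      (universal-reflect h (subst (Universal J) (sym eq) (apex-universal i)))

  ⊏-⊕K : ∀ {G m} → F₀ ⊏ G → n F ≤ m → F ⊏ G ⊕K m
  ⊏-⊕K {G} {m} e₀ nF≤m = record { map = ext ; inj = ext-injective ; pres = ext-pres }
    where
    open Join G m
    open ≡-Reasoning

    k : F₀ ⊏ J
    k = ⊏-trans e₀ base-⊏

    ext : Fin (n F) → Fin (n J)
    ext v with universal? F v
    ... | yes _  = apex (inject≤ v nF≤m)
    ... | no ¬uv = map k (proj₁ (cover v ¬uv))

    ext-universal : ∀ {v} → Universal F v → Universal J (ext v)
    ext-universal {v} uv with universal? F v
    ... | yes _  = apex-universal _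
    ... | no ¬uv = ⊥-elim (¬uv uv)

    ext-nonuniversal : ∀ {v} → ¬ Universal F v → ∃ λ v₀ → map e v₀ ≡ v × ext v ≡ map k v₀
    ext-nonuniversal {v} ¬uv with universal? F v
    ... | yes uv  = ⊥-elim (¬uv uv)
    ... | no ¬uv′ = proj₁ (cover v ¬uv′) , proj₂ (cover v ¬uv′) , refl

    ext-injective : Injective _≡_ _≡_ ext
    ext-injective {u} {v} eq with universal? F u | universal? F v
    ... | yes _ | yes _ = inject≤-injective nF≤m nF≤m u v (apex-injective eq)
    ... | yes _ | no _  = ⊥-elim (base≢apex _ _ (sym eq))
    ... | no _  | yes _ = ⊥-elim (base≢apex _ _ eq)
    ... | no ¬uu | no ¬uv = begin
      u                            ≡⟨ sym (proj₂ (cover u ¬uu)) ⟩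
      map e (proj₁ (cover u ¬uu))  ≡⟨ cong (map e) (inj k eq) ⟩
      map e (proj₁ (cover v ¬uv))  ≡⟨ proj₂ (cover v ¬uv) ⟩
      v                            ∎

    ext-pres-universal : ∀ {x} → Universal F x → ∀ y → adj J (ext x) (ext y) ≡ adj F x y
    ext-pres-universal {x} ux y = begin
      adj J (ext x) (ext y)          ≡⟨ universal-adj J (ext-universal ux) (ext y) ⟩
      not (does (ext x ≟ ext y))     ≡⟨ cong not (does-≟-injective ext ext-injective x y) ⟩
      not (does (x ≟ y))             ≡⟨ sym (universal-adj F ux y) ⟩
      adj F x y                      ∎

    ext-pres-nonuniversal : ∀ {x y} → ¬ Universal F x → ¬ Universal F y →
                            adj J (ext x) (ext y) ≡ adj F x y
    ext-pres-nonuniversal {x} {y} ¬ux ¬uy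
      with ext-nonuniversal ¬ux | ext-nonuniversal ¬uy
    ... | x₀ , ex₀≡x , ext-x | y₀ , ey₀≡y , ext-y = begin
      adj J (ext x) (ext y)          ≡⟨ cong₂ (adj J) ext-x ext-y ⟩
      adj J (map k x₀) (map k y₀)    ≡⟨ pres k x₀ y₀ ⟩
      adj F₀ x₀ y₀                   ≡⟨ sym (pres e x₀ y₀) ⟩
      adj F (map e x₀) (map e y₀)    ≡⟨ cong₂ (adj F) ex₀≡x ey₀≡y ⟩
      adj F x y                      ∎

    ext-pres : ∀ x y → adj J (ext x) (ext y) ≡ adj F x y
    -- Split on Dec values rather than `with`, which would unfold ext x in the goal
    -- and no longer match the statements of the two lemmas above.
    ext-pres x y = by-cases (universal? F x) (universal? F y)
      where
      by-cases : Dec (Universal F x) → Dec (Universal F y) → adj J (ext x) (ext y) ≡ adj F x y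
      by-cases (yes ux) _         = ext-pres-universal ux y
      by-cases (no _)   (yes uy)  = trans (Graph.sym J (ext x) (ext y))
                                          (trans (ext-pres-universal uy x) (Graph.sym F y x))
      by-cases (no ¬ux) (no ¬uy)  = ext-pres-nonuniversal ¬ux ¬uy

_∨ᶠ_ : ∀ {k} → Form k → Form k → Form k
φ ∨ᶠ ψ = Not (And (Not φ) (Not ψ))

-- A sentence that is always false; it names a variable x only because the
-- formula language has no constants.
⊥ᶠ : ∀ {k} → Fin k → Form k
⊥ᶠ x = And (Ex x (Eq x x)) (Not (Ex x (Eq x x)))

constᶠ : ∀ {k} → Fin k → Bool → Form k
constᶠ x false = ⊥ᶠ x
constᶠ x true  = Not (⊥ᶠ x)

⋁ᶠ : ∀ {k m} → Fin k → (Fin m → Form k) → Form k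
⋁ᶠ {m = zero}  x φ = ⊥ᶠ x
⋁ᶠ {m = suc m} x φ = φ zero ∨ᶠ ⋁ᶠ x (φ ∘ suc)

atomᴹ : {A : Set} → (A → A → Bool) → Maybe A → Maybe A → Bool
atomᴹ R (just a) (just b) = R a b
atomᴹ R _        _        = false

atomᴹ-map : ∀ {A B : Set} {R : A → A → Bool} {R′ : B → B → Bool} {f : B → A} →
            (∀ a b → R (f a) (f b) ≡ R′ a b) →
            ∀ r r′ → atomᴹ R (Maybe.map f r) (Maybe.map f r′) ≡ atomᴹ R′ r r′
atomᴹ-map R∘f≡R′ (just a) (just b) = R∘f≡R′ a b
atomᴹ-map R∘f≡R′ (just a) nothing  = refl
atomᴹ-map R∘f≡R′ nothing  r′       = refl

module _ {k : ℕ} (G : Graph) where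

  eval-Adj : ∀ (x y : Fin k) ρ → eval G (Adj x y) ρ ≡ atomᴹ (adj G) (ρ x) (ρ y)
  eval-Adj x y ρ with ρ x | ρ y
  ... | just a  | just b  = refl
  ... | just a  | nothing = refl
  ... | nothing | _       = refl

  eval-Eq : ∀ (x y : Fin k) ρ → eval G (Eq x y) ρ ≡ atomᴹ (λ a b → does (a ≟ b)) (ρ x) (ρ y)
  eval-Eq x y ρ with ρ x | ρ y
  ... | just a  | just b  = refl
  ... | just a  | nothing = refl
  ... | nothing | _       = refl

  eval-Ex : ∀ (x : Fin k) φ ρ → eval G (Ex x φ) ρ ≡ anyFin (λ a → eval G φ (update ρ x (just a)))
  eval-Ex x φ ρ = any-tabulate (λ a → eval G φ (update ρ x (just a))) id

  eval-∨ᶠ : ∀ (φ ψ : Form k) ρ → eval G (φ ∨ᶠ ψ) ρ ≡ eval G φ ρ ∨ eval G ψ ρ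
  eval-∨ᶠ φ ψ ρ with eval G φ ρ | eval G ψ ρ
  ... | true  | _     = refl
  ... | false | true  = refl
  ... | false | false = refl

  eval-⊥ᶠ : ∀ (x : Fin k) ρ → eval G (⊥ᶠ x) ρ ≡ false
  eval-⊥ᶠ x ρ = ∧-inverseʳ (eval G (Ex x (Eq x x)) ρ)

  eval-constᶠ : ∀ (x : Fin k) b ρ → eval G (constᶠ x b) ρ ≡ b
  eval-constᶠ x false ρ = eval-⊥ᶠ x ρ
  eval-constᶠ x true  ρ = cong not (eval-⊥ᶠ x ρ)

  eval-⋁ᶠ : ∀ {m} (x : Fin k) (φ : Fin m → Form k) ρ → eval G (⋁ᶠ x φ) ρ ≡ anyFin (λ i → eval G (φ i) ρ)
  eval-⋁ᶠ {zero}  x φ ρ = eval-⊥ᶠ x ρ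
  eval-⋁ᶠ {suc m} x φ ρ =
    trans (eval-∨ᶠ (φ zero) (⋁ᶠ x (φ ∘ suc)) ρ) (cong (eval G (φ zero) ρ ∨_) (eval-⋁ᶠ x (φ ∘ suc) ρ))

module _ {k : ℕ} {B : Subset k} where

  ∨ᶠ-closed : ∀ {φ ψ} → ClosedIn B φ → ClosedIn B ψ → ClosedIn B (φ ∨ᶠ ψ)
  ∨ᶠ-closed φ-closed ψ-closed = notC (andC (notC φ-closed) (notC ψ-closed))

  ⊥ᶠ-closed : ∀ x → ClosedIn B (⊥ᶠ x)
  ⊥ᶠ-closed x = andC ∃x-closed (notC ∃x-closed)
    where
    x∈B∪x : x ∈ B ∪ ⁅ x ⁆
    x∈B∪x = x∈p∪q⁺ (inj₂ (x∈⁅x⁆ x))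
    ∃x-closed : ClosedIn B (Ex x (Eq x x))
    ∃x-closed = exC (eqC x∈B∪x x∈B∪x)

  constᶠ-closed : ∀ x b → ClosedIn B (constᶠ x b)
  constᶠ-closed x false = ⊥ᶠ-closed x
  constᶠ-closed x true  = notC (⊥ᶠ-closed x)

  ⋁ᶠ-closed : ∀ {m} x (φ : Fin m → Form k) → (∀ i → ClosedIn B (φ i)) → ClosedIn B (⋁ᶠ x φ)
  ⋁ᶠ-closed {zero}  x φ φ-closed = ⊥ᶠ-closed x
  ⋁ᶠ-closed {suc m} x φ φ-closed = ∨ᶠ-closed (φ-closed zero) (⋁ᶠ-closed x (φ ∘ suc) (φ-closed ∘ suc))

-- The clique
-- assignment σ records which variables currently denote a clique vertex (and
-- which one); all other variables keep denoting vertices of G.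
module Translation (m : ℕ) where

  -- A clique vertex is adjacent to every vertex of G, and Eq y y only asks that y be assigned.
  trAdj : ∀ {k} → Fin k → Fin k → Maybe (Fin m) → Maybe (Fin m) → Form k
  trAdj x y nothing  nothing  = Adj x y
  trAdj x y (just _) nothing  = Eq y y
  trAdj x y nothing  (just _) = Eq x x
  trAdj x y (just i) (just j) = constᶠ x (not (does (i ≟ j)))

  trEq : ∀ {k} → Fin k → Fin k → Maybe (Fin m) → Maybe (Fin m) → Form k
  trEq x y nothing  nothing  = Eq x y
  trEq x y (just _) nothing  = ⊥ᶠ x
  trEq x y nothing  (just _) = ⊥ᶠ x
  trEq x y (just i) (just j) = constᶠ x (does (i ≟ j))

  tr : ∀ {k} → (Fin k → Maybe (Fin m)) → Form k → Form k
  tr σ (Adj x y) = trAdj x y (σ x) (σ y)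
  tr σ (Eq x y)  = trEq x y (σ x) (σ y)
  tr σ (Not φ)   = Not (tr σ φ)
  tr σ (And φ ψ) = And (tr σ φ) (tr σ ψ)
  tr σ (Ex x φ)  = Ex x (tr (update σ x nothing) φ) ∨ᶠ ⋁ᶠ x (λ i → tr (update σ x (just i)) φ)

  tr-closed : ∀ {k} {B Bᴳ : Subset k} (φ : Form k) σ → ClosedIn B φ →
              (∀ {v} → v ∈ B → σ v ≡ nothing → v ∈ Bᴳ) → ClosedIn Bᴳ (tr σ φ)
  tr-closed (Adj x y) σ (adjC x∈B y∈B) B⊆Bᴳ with σ x in σx | σ y in σy
  ... | nothing | nothing = adjC (B⊆Bᴳ x∈B σx) (B⊆Bᴳ y∈B σy)
  ... | just _  | nothing = eqC (B⊆Bᴳ y∈B σy) (B⊆Bᴳ y∈B σy)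
  ... | nothing | just _  = eqC (B⊆Bᴳ x∈B σx) (B⊆Bᴳ x∈B σx)
  ... | just _  | just _  = constᶠ-closed x _
  tr-closed (Eq x y) σ (eqC x∈B y∈B) B⊆Bᴳ with σ x in σx | σ y in σy
  ... | nothing | nothing = eqC (B⊆Bᴳ x∈B σx) (B⊆Bᴳ y∈B σy)
  ... | just _  | nothing = ⊥ᶠ-closed x
  ... | nothing | just _  = ⊥ᶠ-closed x
  ... | just _  | just _  = constᶠ-closed x _
  tr-closed (Not φ) σ (notC φ-closed) B⊆Bᴳ = notC (tr-closed φ σ φ-closed B⊆Bᴳ)
  tr-closed (And φ ψ) σ (andC φ-closed ψ-closed) B⊆Bᴳ =
    andC (tr-closed φ σ φ-closed B⊆Bᴳ) (tr-closed ψ σ ψ-closed B⊆Bᴳ)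
  tr-closed {B = B} {Bᴳ} (Ex x φ) σ (exC φ-closed) B⊆Bᴳ =
    ∨ᶠ-closed (exC (tr-closed φ (update σ x nothing) φ-closed on-base))
              (⋁ᶠ-closed x _ λ i → tr-closed φ (update σ x (just i)) φ-closed (on-apex i))
    where
    on-base : ∀ {v} → v ∈ B ∪ ⁅ x ⁆ → update σ x nothing v ≡ nothing → v ∈ Bᴳ ∪ ⁅ x ⁆
    on-base {v} v∈B∪x σv with x∈p∪q⁻ B ⁅ x ⁆ v∈B∪x | x ≟ v
    ... | inj₂ v∈x | _        = x∈p∪q⁺ (inj₂ v∈x)
    ... | inj₁ _   | yes refl = x∈p∪q⁺ (inj₂ (x∈⁅x⁆ x))
    ... | inj₁ v∈B | no _     = x∈p∪q⁺ (inj₁ (B⊆Bᴳ v∈B σv))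

    on-apex : ∀ i {v} → v ∈ B ∪ ⁅ x ⁆ → update σ x (just i) v ≡ nothing → v ∈ Bᴳ
    on-apex i {v} v∈B∪x σv with x ≟ v
    ... | yes refl = case σv of λ ()
    ... | no x≢v with x∈p∪q⁻ B ⁅ x ⁆ v∈B∪x
    ...   | inj₁ v∈B = B⊆Bᴳ v∈B σv
    ...   | inj₂ v∈x = ⊥-elim (x≢v (sym (x∈⁅y⁆⇒x≡y x v∈x)))

  module Soundness (G : Graph) where
    open Join G m
    open ≡-Reasoning

    place : Maybe (Fin m) → Maybe (Fin (n G)) → Maybe (Fin (n J))
    place (just i) _ = just (apex i)
    place nothing  r = Maybe.map base r

    adj-apex-placed : ∀ i r → atomᴹ (adj J) (just (apex i)) (place nothing r) ≡ atomᴹ (λ a b → does (a ≟ b)) r r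
    adj-apex-placed i nothing  = refl
    adj-apex-placed i (just b) = trans (adj-apex-base i b) (sym (does-refl b))

    adj-placed-apex : ∀ r j → atomᴹ (adj J) (place nothing r) (just (apex j)) ≡ atomᴹ (λ a b → does (a ≟ b)) r r
    adj-placed-apex nothing  j = refl
    adj-placed-apex (just a) j = trans (adj-base-apex a j) (sym (does-refl a))

    eq-apex-placed : ∀ i r → atomᴹ (λ a b → does (a ≟ b)) (just (apex i)) (place nothing r) ≡ false
    eq-apex-placed i nothing  = refl
    eq-apex-placed i (just b) = dec-false (apex i ≟ base b) (base≢apex b i ∘ sym)

    eq-placed-apex : ∀ r j → atomᴹ (λ a b → does (a ≟ b)) (place nothing r) (just (apex j)) ≡ false
    eq-placed-apex nothing  j = refl
    eq-placed-apex (just a) j = dec-false (base a ≟ apex j) (base≢apex a j)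

    adj-place : ∀ {k} (x y : Fin k) i j (ρ₀ : Assign k G) →
                atomᴹ (adj J) (place i (ρ₀ x)) (place j (ρ₀ y)) ≡ eval G (trAdj x y i j) ρ₀
    adj-place x y nothing nothing ρ₀ =
      trans (atomᴹ-map adj-base-base (ρ₀ x) (ρ₀ y)) (sym (eval-Adj G x y ρ₀))
    adj-place x y (just i) nothing ρ₀ = trans (adj-apex-placed i (ρ₀ y)) (sym (eval-Eq G y y ρ₀))
    adj-place x y nothing (just j) ρ₀ = trans (adj-placed-apex (ρ₀ x) j) (sym (eval-Eq G x x ρ₀))
    adj-place x y (just i) (just j) ρ₀ = trans (adj-apex-apex i j) (sym (eval-constᶠ G x _ ρ₀))

    eq-place : ∀ {k} (x y : Fin k) i j (ρ₀ : Assign k G) →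
               atomᴹ (λ a b → does (a ≟ b)) (place i (ρ₀ x)) (place j (ρ₀ y)) ≡ eval G (trEq x y i j) ρ₀
    eq-place x y nothing nothing ρ₀ =
      trans (atomᴹ-map (does-≟-injective base base-injective) (ρ₀ x) (ρ₀ y)) (sym (eval-Eq G x y ρ₀))
    eq-place x y (just i) nothing ρ₀ = trans (eq-apex-placed i (ρ₀ y)) (sym (eval-⊥ᶠ G x ρ₀))
    eq-place x y nothing (just j) ρ₀ = trans (eq-placed-apex (ρ₀ x) j) (sym (eval-⊥ᶠ G x ρ₀))
    eq-place x y (just i) (just j) ρ₀ =
      trans (does-≟-injective apex apex-injective i j) (sym (eval-constᶠ G x _ ρ₀))

    sound : ∀ {k} (φ : Form k) σ (ρ₀ : Assign k G) (ρ : Assign k J) →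
            (∀ y → ρ y ≡ place (σ y) (ρ₀ y)) → eval J φ ρ ≡ eval G (tr σ φ) ρ₀
    sound (Adj x y) σ ρ₀ ρ ρ≡ = begin
      eval J (Adj x y) ρ                                        ≡⟨ eval-Adj J x y ρ ⟩
      atomᴹ (adj J) (ρ x) (ρ y)                                 ≡⟨ cong₂ (atomᴹ (adj J)) (ρ≡ x) (ρ≡ y) ⟩
      atomᴹ (adj J) (place (σ x) (ρ₀ x)) (place (σ y) (ρ₀ y))   ≡⟨ adj-place x y (σ x) (σ y) ρ₀ ⟩
      eval G (tr σ (Adj x y)) ρ₀                                ∎
    sound (Eq x y) σ ρ₀ ρ ρ≡ = begin
      eval J (Eq x y) ρ                                         ≡⟨ eval-Eq J x y ρ ⟩
      atomᴹ _ (ρ x) (ρ y)                                       ≡⟨ cong₂ (atomᴹ _) (ρ≡ x) (ρ≡ y) ⟩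
      atomᴹ _ (place (σ x) (ρ₀ x)) (place (σ y) (ρ₀ y))         ≡⟨ eq-place x y (σ x) (σ y) ρ₀ ⟩
      eval G (tr σ (Eq x y)) ρ₀                                 ∎
    sound (Not φ)   σ ρ₀ ρ ρ≡ = cong not (sound φ σ ρ₀ ρ ρ≡)
    sound (And φ ψ) σ ρ₀ ρ ρ≡ = cong₂ _∧_ (sound φ σ ρ₀ ρ ρ≡) (sound ψ σ ρ₀ ρ ρ≡)
    sound (Ex x φ)  σ ρ₀ ρ ρ≡ = begin
      eval J (Ex x φ) ρ
        ≡⟨ eval-Ex J x φ ρ ⟩
      anyFin (λ c → eval J φ (update ρ x (just c)))
        ≡⟨ anyFin-+ (n G) _ ⟩
      anyFin (λ a → eval J φ (update ρ x (just (base a)))) ∨ anyFin (λ i → eval J φ (update ρ x (just (apex i))))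
        ≡⟨ cong₂ _∨_ (anyFin-cong λ a → sound φ _ _ _ (on-base a)) (anyFin-cong λ i → sound φ _ _ _ (on-apex i)) ⟩
      anyFin (λ a → eval G φᴳ (update ρ₀ x (just a))) ∨ anyFin (λ i → eval G (φᴷ i) ρ₀)
        ≡⟨ cong₂ _∨_ (sym (eval-Ex G x φᴳ ρ₀)) (sym (eval-⋁ᶠ G x φᴷ ρ₀)) ⟩
      eval G (Ex x φᴳ) ρ₀ ∨ eval G (⋁ᶠ x φᴷ) ρ₀
        ≡⟨ sym (eval-∨ᶠ G (Ex x φᴳ) (⋁ᶠ x φᴷ) ρ₀) ⟩
      eval G (tr σ (Ex x φ)) ρ₀ ∎
      where
      φᴳ : Form _
      φᴳ = tr (update σ x nothing) φ
      φᴷ : Fin m → Form _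
      φᴷ i = tr (update σ x (just i)) φ

      on-base : ∀ a y → update ρ x (just (base a)) y ≡ place (update σ x nothing y) (update ρ₀ x (just a) y)
      on-base a y with does (x ≟ y)
      ... | true  = refl
      ... | false = ρ≡ y

      on-apex : ∀ i y → update ρ x (just (apex i)) y ≡ place (update σ x (just i) y) (ρ₀ y)
      on-apex i y with does (x ≟ y)
      ... | true  = refl
      ... | false = ρ≡ y

⊕K-W≥ : ∀ m G H → W≥ (G ⊕K m) (H ⊕K m) G H
⊕K-W≥ m G H k (φ , φ-closed , differ) =
  tr unplaced φ , tr-closed φ unplaced φ-closed (λ v∈B _ → v∈B) ,
  λ same → differ (trans (translate G) (trans same (sym (translate H))))
  where
  open Translation m
  unplaced : Fin k → Maybe (Fin m)
  unplaced _ = nothing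
  translate : ∀ B → (B ⊕K m) ⊨ φ ≡ B ⊨ tr unplaced φ
  translate B = Soundness.sound B φ unplaced _ _ λ _ → refl

lemma5p2 : (F F₀ : Graph) → IsRemoveUniversal F F₀ →
    (s : ℕ) → (G₀ H₀ : Graph) → F₀ ⊏ G₀ → ¬ (F₀ ⊏ H₀) →
    Σ Graph λ G → Σ Graph λ H →
      SConnected s G × SConnected s H × F ⊏ G × ¬ (F ⊏ H) × W≥ G H G₀ H₀
lemma5p2 F F₀ R s G₀ H₀ F₀⊏G₀ F₀⋢H₀ =
  G₀ ⊕K m , H₀ ⊕K m ,
  Join.sConnected G₀ m s<m , Join.sConnected H₀ m s<m ,
  ⊏-⊕K R F₀⊏G₀ nF≤m ,
  F₀⋢H₀ ∘ ⊏-⊕K⁻¹ R ,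
  ⊕K-W≥ m G₀ H₀
  where
  m : ℕ
  m = suc (s + n F)
  s<m : s < m
  s<m = s≤s (m≤m+n s (n F))
  nF≤m : n F ≤ m
  nF≤m = m≤n⇒m≤1+n (m≤n+m (n F) s)
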